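{- Let $\pi$ be an involution (a permutation with $\pi=\pi^{ -1}$) and let $\sigma,\sigma'\in S_n$. Then the $3$-permutation $(\sigma,\sigma')$ avoids $\pi$ if and only if the $3$-permutation $(\sigma',\sigma)$ avoids $\pi$.
   Context: A $3$-permutation of size $n$ is an ordered pair $(\sigma,\sigma')$ of permutations of $[n]=\{1,\dots,n\}$. A (classical) permutation $\tau\in S_n$ contains a pattern $\pi\in S_k$ if there are indices $c_1<\dots<c_k$ such that $\tau(c_1)\cdots\tau(c_k)$ is order-isomorphic to $\pi$, and avoids $\pi$ otherwise. A $3$-permutation $(\sigma,\sigma')$ avoids a pattern $\pi\in S_k$ if each of the three permutations $\sigma$, $\sigma'$, and $\sigma'\circ\sigma^{ -1}$ (where $(\sigma'\circ\sigma^{ -1})(i)=\sigma'(\sigma^{ -1}(i))$) avoids $\pi$. -}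

module Defs where

open import Data.Nat using (ℕ)
open import Data.Fin using (Fin; _<_)
open import Data.Fin.Permutation using (Permutation′; _⟨$⟩ʳ_; _⟨$⟩ˡ_)
open import Data.Product using (Σ; _×_)
open import Function.Bundles using (_⇔_)
open import Relation.Binary.PropositionalEquality using (_≡_)
open import Relation.Nullary using (¬_)

Contains : {n k : ℕ} → (Fin n → Fin n) → Permutation′ k → Set
Contains {n} {k} τ π =
  Σ (Fin k → Fin n) λ c →
    ((i j : Fin k) → i < j → c i < c j) ×
    ((i j : Fin k) → (τ (c i) < τ (c j)) ⇔ ((π ⟨$⟩ʳ i) < (π ⟨$⟩ʳ j)))

Avoids : {n k : ℕ} → (Fin n → Fin n) → Permutation′ k → Set
Avoids τ π = ¬ Contains τ π

IsInvolution : {k : ℕ} → Permutation′ k → Set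
IsInvolution {k} π = (i : Fin k) → π ⟨$⟩ʳ (π ⟨$⟩ʳ i) ≡ i

ThreeAvoids : {n k : ℕ} → Permutation′ n → Permutation′ n → Permutation′ k → Set
ThreeAvoids σ σ' π =
  Avoids (σ ⟨$⟩ʳ_) π ×
  Avoids (σ' ⟨$⟩ʳ_) π ×
  Avoids (λ i → σ' ⟨$⟩ʳ (σ ⟨$⟩ˡ i)) π

{-# OPTIONS --safe #-}
-- Reading an occurrence of π in τ through τ⁻¹ gives an occurrence of π⁻¹ in τ⁻¹,
-- so τ avoids π iff τ⁻¹ avoids π⁻¹, which for an involution is π itself. Swapping
-- σ and σ' exchanges the first two conditions of 3-avoidance and replaces σ' ∘ σ⁻¹
-- by its inverse σ ∘ σ'⁻¹ in the third.
module Submission where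

open import Defs
open import Data.Nat using (ℕ)
open import Data.Fin using (Fin; _<_)
open import Data.Fin.Properties using (<-cmp; <-irrefl; <-asym)
open import Data.Fin.Permutation
  using (Permutation′; _⟨$⟩ʳ_; _⟨$⟩ˡ_; flip; inverseˡ; inverseʳ)
open import Data.Product using (_,_)
open import Data.Empty using (⊥-elim)
open import Function.Bundles using (_⇔_; mk⇔; Equivalence)
open import Relation.Binary.Definitions using (tri<; tri≈; tri>)
open import Relation.Binary.PropositionalEquality
  using (_≡_; refl; sym; trans; cong; subst₂; module ≡-Reasoning)

private
  variable
    n k : ℕ

increasing⇒reflects-< : (c : Fin k → Fin n) → (∀ i j → i < j → c i < c j) →
                        ∀ i j → c i < c j → i < j
increasing⇒reflects-< c increasing i j ci<cj with <-cmp i j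
... | tri< i<j _ _ = i<j
... | tri≈ _ refl _ = ⊥-elim (<-irrefl refl ci<cj)
... | tri> _ _ j<i = ⊥-elim (<-asym ci<cj (increasing j i j<i))

Contains-resp-pattern : (τ : Fin n → Fin n) (π π′ : Permutation′ k) →
                        (∀ i → π ⟨$⟩ʳ i ≡ π′ ⟨$⟩ʳ i) → Contains τ π → Contains τ π′
Contains-resp-pattern τ π π′ π≗π′ (c , increasing , iso) =
  c , increasing , λ i j → subst₂ (λ x y → _ ⇔ (x < y)) (π≗π′ i) (π≗π′ j) (iso i j)

-- The occurrence of π⁻¹ in ρ = τ⁻¹ sits at the positions τ (c (π⁻¹ i)).
Contains-inverse : {n k : ℕ} (π : Permutation′ k) (τ ρ : Fin n → Fin n) →
                   (∀ x → ρ (τ x) ≡ x) → Contains τ π → Contains ρ (flip π)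
Contains-inverse {n} {k} π τ ρ ρ∘τ≗id (c , increasing , iso) =
  d , d-increasing , d-iso
  where
  d : Fin k → Fin n
  d i = τ (c (π ⟨$⟩ˡ i))

  d-increasing : ∀ i j → i < j → d i < d j
  d-increasing i j i<j = Equivalence.from (iso (π ⟨$⟩ˡ i) (π ⟨$⟩ˡ j))
    (subst₂ _<_ (sym (inverseʳ π)) (sym (inverseʳ π)) i<j)

  d-iso : ∀ i j → (ρ (d i) < ρ (d j)) ⇔ (π ⟨$⟩ˡ i < π ⟨$⟩ˡ j)
  d-iso i j = mk⇔
    (λ ρdi<ρdj → increasing⇒reflects-< c increasing _ _
                   (subst₂ _<_ (ρ∘τ≗id _) (ρ∘τ≗id _) ρdi<ρdj))
    (λ πi<πj → subst₂ _<_ (sym (ρ∘τ≗id _)) (sym (ρ∘τ≗id _))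
                 (increasing _ _ πi<πj))

involution⇒inverse≗self : (π : Permutation′ k) → IsInvolution π →
                          ∀ i → π ⟨$⟩ˡ i ≡ π ⟨$⟩ʳ i
involution⇒inverse≗self π involution i = begin
  π ⟨$⟩ˡ i                    ≡⟨ cong (π ⟨$⟩ˡ_) (sym (involution i)) ⟩
  π ⟨$⟩ˡ (π ⟨$⟩ʳ (π ⟨$⟩ʳ i))  ≡⟨ inverseˡ π ⟩
  π ⟨$⟩ʳ i                    ∎
  where open ≡-Reasoning

Avoids-inverse-of-involution : (π : Permutation′ k) → IsInvolution π →
                               (τ ρ : Fin n → Fin n) → (∀ x → τ (ρ x) ≡ x) →
                               Avoids τ π → Avoids ρ π
Avoids-inverse-of-involution π involution τ ρ τ∘ρ≗id τ-avoids ρ-contains =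
  τ-avoids (Contains-resp-pattern τ (flip π) π
             (involution⇒inverse≗self π involution)
             (Contains-inverse π ρ τ τ∘ρ≗id ρ-contains))

ThreeAvoids-swap : (π : Permutation′ k) → IsInvolution π → (σ σ' : Permutation′ n) →
                   ThreeAvoids σ σ' π → ThreeAvoids σ' σ π
ThreeAvoids-swap π involution σ σ' (σ-avoids , σ'-avoids , σ'σ⁻¹-avoids) =
  σ'-avoids , σ-avoids , Avoids-inverse-of-involution π involution
    (λ x → σ' ⟨$⟩ʳ (σ ⟨$⟩ˡ x)) (λ x → σ ⟨$⟩ʳ (σ' ⟨$⟩ˡ x)) σ'σ⁻¹∘σσ'⁻¹≗id σ'σ⁻¹-avoids
  where
  σ'σ⁻¹∘σσ'⁻¹≗id : ∀ x → σ' ⟨$⟩ʳ (σ ⟨$⟩ˡ (σ ⟨$⟩ʳ (σ' ⟨$⟩ˡ x))) ≡ x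
  σ'σ⁻¹∘σσ'⁻¹≗id x = trans (cong (σ' ⟨$⟩ʳ_) (inverseˡ σ)) (inverseʳ σ')

corollary3p6 : (n k : ℕ) (π : Permutation′ k) → IsInvolution π →
    (σ σ' : Permutation′ n) →
    ThreeAvoids σ σ' π ⇔ ThreeAvoids σ' σ π
corollary3p6 n k π involution σ σ' =
  mk⇔ (ThreeAvoids-swap π involution σ σ') (ThreeAvoids-swap π involution σ' σ)
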